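{- Let $\psi:l_v^\times\to\mathcal O^\times$ be a character not factoring through the norm $l_v^\times\to k_v^\times$. The cuspidal type $\Theta(\psi)$ is regular if and only if there is some $i\in\mathcal S$ such that $\{i,\dots,f-1\}\in\mathcal P_{\Theta(\psi)}$ and $\{0,\dots,i-1\}\in\mathcal P_{\Theta(\psi)}$. If $\Theta(\psi)$ is irregular, then there is a unique $J\in\mathcal P_{\Theta(\psi)}$ such that the Serre weight $\overline{\Theta}(\psi)_J$ is regular.
   Context: $k_v=\mathbb F_q$, $q=p^f$, $l_v$ the quadratic extension, $\mathcal S=\{0,\dots,f-1\}$ (indices cyclic mod $f$). $E/\mathbb{Q}_p$ finite with ring of integers $\mathcal O$ and residue field $\mathbb F$ containing an embedding of $l_v$; fix $\overline{\kappa}_0:k_v\hookrightarrow\mathbb F$, $\overline{\kappa}_i$ with $\overline\kappa_{i+1}^p=\overline\kappa_i$; $[\cdot]$ denotes the Teichmüller lift (via the fixed embeddings), and on the mod $p$ side $[\cdot]$ also denotes $x\mapsto\overline\kappa_0(x)$. $\Theta(\psi)$ is the irreducible cuspidal $E$-representation of $\mathrm{GL}_2(k_v)$ attached to $\psi$. Write $\psi=[x]^{(q+1)b+1+c}$ with $0\le b\le q-2$, $0\le c\le q-1$, $c=\sum_{i=0}^{f-1}c_ip^i$, $0\le c_i\le p-1$. $\Theta(\psi)$ is regular if some $0<c_i<p-1$, irregular otherwise. For $J\subseteq\mathcal S$ put $J_0=J\triangle\{f-1\}$; $\mathcal P_{\Theta(\psi)}$ is the set of $J\subseteq\mathcal S$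 such that: if $j\in J$ and $j-1\notin J_0$ then $c_j\neq p-1$; if $j\notin J$ and $j-1\in J_0$ then $c_j\neq 0$. For $J\in\mathcal P_{\Theta(\psi)}$ set $s_{J,i}=p-1-c_i-\delta_{J_0^c}(i-1)$ if $i\in J$, $s_{J,i}=c_i-\delta_{J_0}(i-1)$ if $i\notin J$, $t_{J,i}=c_i+\delta_{J^c}(i-1)$ if $i\in J$ and $0$ otherwise ($\delta_X$ the characteristic function), and $\overline{\Theta}(\psi)_J=\overline{\sigma}_{\vec t,\vec s}\otimes[\cdot]^{(q+1)b+\delta_J(0)\delta_J(f-1)+\delta_{J^c}(0)\delta_{J^c}(f-1)}\circ\det$, where $\overline{\sigma}_{\vec t,\vec s}=\bigotimes_{j=0}^{f-1}(\det^{t_j}\mathrm{Sym}^{s_j}k_v^2)\otimes_{k_v,\overline\kappa_{ -j}}\mathbb F$. A Serre weight $\overline\sigma_{\vec t,\vec s}$ is regular if no $s_j$ equals $p-1$. -}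

module Defs where

open import Data.Nat using (ℕ; zero; suc; _+_; _*_; _∸_; _^_; _/_; _%_; _≤ᵇ_; _<ᵇ_; _<_; _≤_)
open import Data.Fin using (Fin; zero; suc; toℕ; fromℕ; inject₁)
open import Data.Fin.Subset using (Subset; _∈_; _∉_; ⁅_⁆; ∁)
open import Data.Vec using (Vec; lookup; tabulate; zipWith)
open import Data.Bool using (Bool; true; false; _xor_; if_then_else_)
open import Data.Product using (_×_; ∃-syntax)
open import Relation.Binary.PropositionalEquality using (_≡_; _≢_)

-- Throughout, f = suc k (so f ≥ 1) and S = Fin f with indices cyclic mod f.

divPow : ℕ → ℕ → ℕ → ℕ
divPow zero    c _       = 0
divPow (suc p) c zero    = c
divPow (suc p) c (suc i) = divPow (suc p) c i / suc p

digit : (p c : ℕ) → ℕ → ℕ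
digit zero    c i = 0
digit (suc p) c i = divPow (suc p) c i % suc p

cpred : {k : ℕ} → Fin (suc k) → Fin (suc k)
cpred {k} zero = fromℕ k
cpred (suc i)  = inject₁ i

δ : {n : ℕ} → Subset n → Fin n → ℕ
δ X i = if lookup X i then 1 else 0

J₀ : {k : ℕ} → Subset (suc k) → Subset (suc k)
J₀ {k} J = zipWith _xor_ J ⁅ fromℕ k ⁆

RegularΘ : (p k c : ℕ) → Set
RegularΘ p k c = ∃[ i ] (0 < digit p c (toℕ {suc k} i) × digit p c (toℕ i) < p ∸ 1)

InP : (p k c : ℕ) → Subset (suc k) → Set
InP p k c J = ∀ (j : Fin (suc k)) →
  ((j ∈ J → cpred j ∉ J₀ J → digit p c (toℕ j) ≢ p ∸ 1) ×
   (j ∉ J → cpred j ∈ J₀ J → digit p c (toℕ j) ≢ 0))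

upperSet : {k : ℕ} → Fin (suc k) → Subset (suc k)
upperSet i = tabulate (λ j → toℕ i ≤ᵇ toℕ j)

lowerSet : {k : ℕ} → Fin (suc k) → Subset (suc k)
lowerSet i = tabulate (λ j → toℕ j <ᵇ toℕ i)

-- Serre weight  σ̄_{t,s} ⊗ [·]^e ∘ det, recorded by (t, s, e)
record SerreWeight (f : ℕ) : Set where
  constructor weight
  field
    t : Fin f → ℕ
    s : Fin f → ℕ
    e : ℕ

RegularWeight : (p : ℕ) {f : ℕ} → SerreWeight f → Set
RegularWeight p σ = ∀ j → SerreWeight.s σ j ≢ p ∸ 1

s-J : (p k c : ℕ) → Subset (suc k) → Fin (suc k) → ℕ
s-J p k c J i = if lookup J i
  then (p ∸ 1) ∸ digit p c (toℕ i) ∸ δ (∁ (J₀ J)) (cpred i)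
  else digit p c (toℕ i) ∸ δ (J₀ J) (cpred i)

t-J : (p k c : ℕ) → Subset (suc k) → Fin (suc k) → ℕ
t-J p k c J i = if lookup J i then digit p c (toℕ i) + δ (∁ J) (cpred i) else 0

ΘbarJ : (p k b c : ℕ) → Subset (suc k) → SerreWeight (suc k)
ΘbarJ p k b c J = weight (t-J p k c J) (s-J p k c J)
  ((p ^ suc k + 1) * b
    + δ J zero * δ J (fromℕ k) + δ (∁ J) zero * δ (∁ J) (fromℕ k))

{-# OPTIONS --safe #-}
-- Membership of J in 𝒫 and regularity of the weight Θ̄(ψ)_J are conditions at each index j on
-- the triple (j ∈ J, j − 1 ∈ J₀, c_j). For J = {i, …, f−1} one finds j − 1 ∈ J₀ exactly when i < j,
-- so the only condition left is c_i ≠ p − 1 at j = i; for J = {0, …, i−1}, j − 1 ∈ J₀ exactly when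
-- j ≤ i, and the only condition left is c_i ≠ 0. Hence both sets lie in 𝒫 iff 0 < c_i < p − 1.
-- If Θ(ψ) is irregular every digit is 0 or p − 1, and inspecting the four values of the two
-- booleans shows that J ∈ 𝒫 with s_{J,j} ≠ p − 1 holds exactly when j − 1 ∈ J₀ ⟺ c_j = p − 1.
-- This prescribes J₀ at every index, and J ↦ J₀ is an involution, so there is exactly one such J.
module Submission where

open import Defs
open import Data.Nat using (ℕ; zero; suc; _∸_; _^_; _≤_; _<_; _≤ᵇ_; _<ᵇ_; z≤n; s≤s; s≤s⁻¹)
open import Data.Nat.Properties
  using (_≟_; ≤-refl; <⇒≤; 0≢1+n; <⇒≢; <⇒≱; <-irrefl; ≤∧≢⇒<; ≤∧≮⇒≡; n≢0⇒n>0; 1+n≢n; n∸n≡0; ≤ᵇ⇒≤; ≤⇒≤ᵇ; <ᵇ⇒<; <⇒<ᵇ)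
open import Data.Nat.Primality using (Prime; ¬prime[0]; ¬prime[1])
open import Data.Nat.DivMod using (m%n<n)
open import Data.Fin using (Fin; zero; suc; toℕ; fromℕ; inject₁; lower₁)
open import Data.Fin.Properties
  using (toℕ-injective; toℕ-fromℕ; toℕ-inject₁; toℕ-inject₁-≢; ≤fromℕ; fromℕ≢inject₁; inject₁-lower₁; lower₁-inject₁′)
open import Data.Fin.Subset using (Subset; _∈_; _∉_; ⁅_⁆)
open import Data.Fin.Subset.Properties using (x∈⁅x⁆; x≢y⇒x∉⁅y⁆)
open import Data.Vec using (Vec; []; _∷_; lookup; tabulate; zipWith)
open import Data.Vec.Properties
  using (lookup∘tabulate; tabulate∘lookup; tabulate-cong; lookup-zipWith; lookup-map; []=⇒lookup; lookup⇒[]=)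
open import Data.Bool using (Bool; true; false; not; _xor_; if_then_else_; T)
open import Data.Bool.Properties using (T-≡; not-¬; not-injective; xor-assoc; xor-same; xor-identityʳ; xor-comm)
open import Data.Product using (_×_; ∃-syntax; ∃!; _,_; proj₁; proj₂)
open import Function using (_∘_)
open import Function.Bundles using (_⇔_; mk⇔; Equivalence)
open import Relation.Nullary using (¬_; yes; no; contradiction)
open import Relation.Binary.PropositionalEquality
  using (_≡_; _≢_; refl; sym; trans; cong; cong₂; subst; ≢-sym; module ≡-Reasoning)

open Equivalence using (to; from)

∉⇔lookup≡false : ∀ {n} {J : Subset n} {x : Fin n} → x ∉ J ⇔ lookup J x ≡ false
∉⇔lookup≡false {J = J} {x} = mk⇔ to′ (λ eq x∈J → not-¬ ([]=⇒lookup x∈J) eq)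
  where
  to′ : x ∉ J → lookup J x ≡ false
  to′ x∉J with lookup J x in eq
  ... | true  = contradiction (lookup⇒[]= x J eq) x∉J
  ... | false = refl

∈-tabulate⇔ : ∀ {n} (f : Fin n → Bool) {x : Fin n} → x ∈ tabulate f ⇔ T (f x)
∈-tabulate⇔ f {x} = mk⇔
  (λ x∈ → from T-≡ (trans (sym (lookup∘tabulate f x)) ([]=⇒lookup x∈)))
  (λ fx → lookup⇒[]= x (tabulate f) (trans (lookup∘tabulate f x) (to T-≡ fx)))

lookup-ext : ∀ {A : Set} {n} {u v : Vec A n} → (∀ i → lookup u i ≡ lookup v i) → u ≡ v
lookup-ext {u = u} {v} eq = trans (sym (tabulate∘lookup u)) (trans (tabulate-cong eq) (tabulate∘lookup v))

zipWith-xor-involutive : ∀ {n} (u v : Vec Bool n) → zipWith _xor_ (zipWith _xor_ u v) v ≡ u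
zipWith-xor-involutive []       []       = refl
zipWith-xor-involutive (x ∷ xs) (y ∷ ys) = cong₂ _∷_ x-cancel (zipWith-xor-involutive xs ys)
  where
  open ≡-Reasoning
  x-cancel : (x xor y) xor y ≡ x
  x-cancel = begin
    (x xor y) xor y ≡⟨ xor-assoc x y y ⟩
    x xor (y xor y) ≡⟨ cong (x xor_) (xor-same y) ⟩
    x xor false     ≡⟨ xor-identityʳ x ⟩
    x               ∎

J₀-involutive : ∀ {k} (J : Subset (suc k)) → J₀ (J₀ J) ≡ J
J₀-involutive {k} J = zipWith-xor-involutive J ⁅ fromℕ k ⁆

lookup-J₀-fromℕ : ∀ {k} (J : Subset (suc k)) → lookup (J₀ J) (fromℕ k) ≡ not (lookup J (fromℕ k))
lookup-J₀-fromℕ {k} J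
  rewrite lookup-zipWith _xor_ (fromℕ k) J ⁅ fromℕ k ⁆ | []=⇒lookup (x∈⁅x⁆ (fromℕ k))
  = xor-comm (lookup J (fromℕ k)) true

lookup-J₀-inject₁ : ∀ {k} (J : Subset (suc k)) (j : Fin k) → lookup (J₀ J) (inject₁ j) ≡ lookup J (inject₁ j)
lookup-J₀-inject₁ {k} J j
  rewrite lookup-zipWith _xor_ (inject₁ j) J ⁅ fromℕ k ⁆
        | to ∉⇔lookup≡false (x≢y⇒x∉⁅y⁆ {x = inject₁ j} (fromℕ≢inject₁ ∘ sym))
  = xor-identityʳ (lookup J (inject₁ j))

csuc : ∀ {k} → Fin (suc k) → Fin (suc k)
csuc {k} i with k ≟ toℕ i
... | yes _   = zero
... | no k≢i = suc (lower₁ i k≢i)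

cpred-csuc : ∀ {k} (i : Fin (suc k)) → cpred (csuc i) ≡ i
cpred-csuc {k} i with k ≟ toℕ i
... | yes k≡i = toℕ-injective (trans (toℕ-fromℕ k) k≡i)
... | no k≢i  = inject₁-lower₁ i k≢i

csuc-cpred : ∀ {k} (i : Fin (suc k)) → csuc (cpred i) ≡ i
csuc-cpred {k} zero with k ≟ toℕ (fromℕ k)
... | yes _   = refl
... | no k≢k  = contradiction (sym (toℕ-fromℕ k)) k≢k
csuc-cpred {k} (suc i) with k ≟ toℕ (inject₁ i)
... | yes k≡i = contradiction k≡i (toℕ-inject₁-≢ i)
... | no k≢i  = cong suc (lower₁-inject₁′ i k≢i)

cpred-zero∈J₀⇔ : ∀ {k} {J : Subset (suc k)} → cpred zero ∈ J₀ J ⇔ fromℕ k ∉ J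
cpred-zero∈J₀⇔ {k} {J} = mk⇔
  (λ h → from ∉⇔lookup≡false (not-injective (trans (sym (lookup-J₀-fromℕ J)) ([]=⇒lookup h))))
  (λ h → lookup⇒[]= (fromℕ k) (J₀ J) (trans (lookup-J₀-fromℕ J) (cong not (to ∉⇔lookup≡false h))))

cpred-suc∈J₀⇔ : ∀ {k} {J : Subset (suc k)} {j : Fin k} → cpred (suc j) ∈ J₀ J ⇔ inject₁ j ∈ J
cpred-suc∈J₀⇔ {J = J} {j} = mk⇔
  (λ h → lookup⇒[]= (inject₁ j) J (trans (sym (lookup-J₀-inject₁ J j)) ([]=⇒lookup h)))
  (λ h → lookup⇒[]= (inject₁ j) (J₀ J) (trans (lookup-J₀-inject₁ J j) ([]=⇒lookup h)))

module _ {k : ℕ} (i : Fin (suc k)) where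

  ∈-upperSet⇔ : ∀ j → j ∈ upperSet i ⇔ toℕ i ≤ toℕ j
  ∈-upperSet⇔ j = mk⇔ (≤ᵇ⇒≤ _ _ ∘ to (∈-tabulate⇔ (λ x → toℕ i ≤ᵇ toℕ x)))
                      (from (∈-tabulate⇔ (λ x → toℕ i ≤ᵇ toℕ x)) ∘ ≤⇒≤ᵇ)

  ∈-lowerSet⇔ : ∀ j → j ∈ lowerSet i ⇔ toℕ j < toℕ i
  ∈-lowerSet⇔ j = mk⇔ (<ᵇ⇒< _ _ ∘ to (∈-tabulate⇔ (λ x → toℕ x <ᵇ toℕ i)))
                      (from (∈-tabulate⇔ (λ x → toℕ x <ᵇ toℕ i)) ∘ <⇒<ᵇ)

  cpred∈J₀-upperSet⇔ : ∀ j → cpred j ∈ J₀ (upperSet i) ⇔ toℕ i < toℕ j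
  cpred∈J₀-upperSet⇔ zero = mk⇔
    (λ h → contradiction (from (∈-upperSet⇔ (fromℕ k)) (≤fromℕ i)) (to cpred-zero∈J₀⇔ h))
    (λ ())
  cpred∈J₀-upperSet⇔ (suc j) = mk⇔
    (λ h → s≤s (subst (toℕ i ≤_) (toℕ-inject₁ j) (to (∈-upperSet⇔ (inject₁ j)) (to cpred-suc∈J₀⇔ h))))
    (λ i<j → from cpred-suc∈J₀⇔
               (from (∈-upperSet⇔ (inject₁ j)) (subst (toℕ i ≤_) (sym (toℕ-inject₁ j)) (s≤s⁻¹ i<j))))

  cpred∈J₀-lowerSet⇔ : ∀ j → cpred j ∈ J₀ (lowerSet i) ⇔ toℕ j ≤ toℕ i
  cpred∈J₀-lowerSet⇔ zero = mk⇔
    (λ _ → z≤n)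
    (λ _ → from cpred-zero∈J₀⇔ (λ h → <⇒≱ (to (∈-lowerSet⇔ (fromℕ k)) h) (≤fromℕ i)))
  cpred∈J₀-lowerSet⇔ (suc j) = mk⇔
    (λ h → subst (_< toℕ i) (toℕ-inject₁ j) (to (∈-lowerSet⇔ (inject₁ j)) (to cpred-suc∈J₀⇔ h)))
    (λ j<i → from cpred-suc∈J₀⇔
               (from (∈-lowerSet⇔ (inject₁ j)) (subst (_< toℕ i) (sym (toℕ-inject₁ j)) j<i)))

upperSet∈P⇔ : ∀ p c {k} (i : Fin (suc k)) → InP p k c (upperSet i) ⇔ digit p c (toℕ i) ≢ p ∸ 1
upperSet∈P⇔ p c {k} i = mk⇔
  (λ inP → proj₁ (inP i) (from (∈-upperSet⇔ i i) ≤-refl) (<-irrefl refl ∘ to (cpred∈J₀-upperSet⇔ i i)))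
  (λ cᵢ≢p-1 j → only-at-i cᵢ≢p-1 j , λ j∉ cpred∈ →
    contradiction (from (∈-upperSet⇔ i j) (<⇒≤ (to (cpred∈J₀-upperSet⇔ i j) cpred∈))) j∉)
  where
  only-at-i : digit p c (toℕ i) ≢ p ∸ 1 → ∀ j → j ∈ upperSet i → cpred j ∉ J₀ (upperSet i) →
              digit p c (toℕ j) ≢ p ∸ 1
  only-at-i cᵢ≢p-1 j j∈ cpred∉
    with toℕ-injective (≤∧≮⇒≡ (to (∈-upperSet⇔ i j) j∈) (cpred∉ ∘ from (cpred∈J₀-upperSet⇔ i j)))
  ... | refl = cᵢ≢p-1

lowerSet∈P⇔ : ∀ p c {k} (i : Fin (suc k)) → InP p k c (lowerSet i) ⇔ digit p c (toℕ i) ≢ 0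
lowerSet∈P⇔ p c {k} i = mk⇔
  (λ inP → proj₂ (inP i) (<-irrefl refl ∘ to (∈-lowerSet⇔ i i)) (from (cpred∈J₀-lowerSet⇔ i i) ≤-refl))
  (λ cᵢ≢0 j → (λ j∈ cpred∉ →
                contradiction (from (cpred∈J₀-lowerSet⇔ i j) (<⇒≤ (to (∈-lowerSet⇔ i j) j∈))) cpred∉)
            , only-at-i cᵢ≢0 j)
  where
  only-at-i : digit p c (toℕ i) ≢ 0 → ∀ j → j ∉ lowerSet i → cpred j ∈ J₀ (lowerSet i) →
              digit p c (toℕ j) ≢ 0
  only-at-i cᵢ≢0 j j∉ cpred∈
    with toℕ-injective (≤∧≮⇒≡ (to (cpred∈J₀-lowerSet⇔ i j) cpred∈) (j∉ ∘ from (∈-lowerSet⇔ i j)))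
  ... | refl = cᵢ≢0

digit≤pred : ∀ p c n → digit p c n ≤ p ∸ 1
digit≤pred zero    c n = z≤n
digit≤pred (suc p) c n = s≤s⁻¹ (m%n<n (divPow (suc p) c n) (suc p))

regularΘ⇔∃upperSet∈P×lowerSet∈P : ∀ p k c →
  RegularΘ p k c ⇔ (∃[ i ] (InP p k c (upperSet i) × InP p k c (lowerSet i)))
regularΘ⇔∃upperSet∈P×lowerSet∈P p k c = mk⇔
  (λ (i , 0<cᵢ , cᵢ<p-1) → i , from (upperSet∈P⇔ p c i) (<⇒≢ cᵢ<p-1)
                              , from (lowerSet∈P⇔ p c i) (≢-sym (<⇒≢ 0<cᵢ)))
  (λ (i , upper , lower) → i , n≢0⇒n>0 (to (lowerSet∈P⇔ p c i) lower)
                             , ≤∧≢⇒< (digit≤pred p c (toℕ i)) (to (upperSet∈P⇔ p c i) upper))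

-- The condition defining 𝒫 at one index j, for A = [j ∈ J], B = [j − 1 ∈ J₀] and d = c_j.
Admissible : ℕ → Bool → Bool → ℕ → Set
Admissible p A B d = (A ≡ true → B ≡ false → d ≢ p ∸ 1) × (A ≡ false → B ≡ true → d ≢ 0)

InP⇔Admissible : ∀ {p k c} {J : Subset (suc k)} →
  InP p k c J ⇔ (∀ j → Admissible p (lookup J j) (lookup (J₀ J) (cpred j)) (digit p c (toℕ j)))
InP⇔Admissible {J = J} = mk⇔
  (λ inP j → (λ A B → proj₁ (inP j) (lookup⇒[]= j J A) (from ∉⇔lookup≡false B))
           , (λ A B → proj₂ (inP j) (from ∉⇔lookup≡false A) (lookup⇒[]= (cpred j) (J₀ J) B)))
  (λ adm j → (λ j∈ cpred∉ → proj₁ (adm j) ([]=⇒lookup j∈) (to ∉⇔lookup≡false cpred∉))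
           , (λ j∉ cpred∈ → proj₂ (adm j) (to ∉⇔lookup≡false j∉) ([]=⇒lookup cpred∈)))

sWeight : ℕ → Bool → Bool → ℕ → ℕ
sWeight p A B d = if A then p ∸ 1 ∸ d ∸ (if not B then 1 else 0) else d ∸ (if B then 1 else 0)

s-J≡sWeight : ∀ p k c (J : Subset (suc k)) i →
  s-J p k c J i ≡ sWeight p (lookup J i) (lookup (J₀ J) (cpred i)) (digit p c (toℕ i))
s-J≡sWeight p k c J i rewrite lookup-map (cpred i) not (J₀ J) = refl

extremeDigit : ℕ → Bool → ℕ
extremeDigit p e = if e then p ∸ 1 else 0

extreme-admissible-regular⇔ : ∀ q A B e {d} → d ≡ extremeDigit (suc (suc q)) e →
  (Admissible (suc (suc q)) A B d × sWeight (suc (suc q)) A B d ≢ suc q) ⇔ B ≡ e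
extreme-admissible-regular⇔ q A B e refl = mk⇔ (forced A B e) (λ { refl → allowed A B })
  where
  P : ℕ
  P = suc (suc q)
  forced : ∀ A B e → Admissible P A B (extremeDigit P e) × sWeight P A B (extremeDigit P e) ≢ suc q → B ≡ e
  forced A     true  true  _                = refl
  forced A     false false _                = refl
  forced true  true  false (_ , reg)        = contradiction refl reg
  forced false true  false ((_ , adm) , _)  = contradiction refl (adm refl refl)
  forced true  false true  ((adm , _) , _)  = contradiction refl (adm refl refl)
  forced false false true  (_ , reg)        = contradiction refl reg
  allowed : ∀ A B → Admissible P A B (extremeDigit P B) × sWeight P A B (extremeDigit P B) ≢ suc q
  allowed true  true  = ((λ _ ()) , λ ()) , λ s≡ → 0≢1+n (trans (sym (n∸n≡0 q)) s≡)
  allowed true  false = ((λ _ _ ()) , λ ()) , 1+n≢n ∘ sym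
  allowed false true  = ((λ ()) , λ _ _ ()) , 1+n≢n ∘ sym
  allowed false false = ((λ ()) , λ _ ()) , λ ()

∈P×regular⇔J₀-prescribed : ∀ q k b c (e : Fin (suc k) → Bool) →
  (∀ i → digit (suc (suc q)) c (toℕ i) ≡ extremeDigit (suc (suc q)) (e i)) → (J : Subset (suc k)) →
  (InP (suc (suc q)) k c J × RegularWeight (suc (suc q)) (ΘbarJ (suc (suc q)) k b c J))
    ⇔ (∀ i → lookup (J₀ J) (cpred i) ≡ e i)
∈P×regular⇔J₀-prescribed q k b c e cᵢ≡ J = mk⇔
  (λ (inP , reg) i → to (local i) (to InP⇔Admissible inP i , reg i ∘ trans (s-J≡sWeight P k c J i)))
  (λ J₀≡ → from InP⇔Admissible (λ i → proj₁ (from (local i) (J₀≡ i)))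
         , λ i → proj₂ (from (local i) (J₀≡ i)) ∘ trans (sym (s-J≡sWeight P k c J i)))
  where
  P : ℕ
  P = suc (suc q)
  local : ∀ i → (Admissible P (lookup J i) (lookup (J₀ J) (cpred i)) (digit P c (toℕ i))
                   × sWeight P (lookup J i) (lookup (J₀ J) (cpred i)) (digit P c (toℕ i)) ≢ suc q)
                ⇔ lookup (J₀ J) (cpred i) ≡ e i
  local i = extreme-admissible-regular⇔ q (lookup J i) (lookup (J₀ J) (cpred i)) (e i) (cᵢ≡ i)

∃!-J₀-prescribed-on-cpred : ∀ {k} (g : Fin (suc k) → Bool) →
  ∃! _≡_ (λ (J : Subset (suc k)) → ∀ i → lookup (J₀ J) (cpred i) ≡ g i)
∃!-J₀-prescribed-on-cpred g = J₀ K , prescribed , unique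
  where
  open ≡-Reasoning
  K : Subset (suc _)
  K = tabulate (g ∘ csuc)
  prescribed : ∀ i → lookup (J₀ (J₀ K)) (cpred i) ≡ g i
  prescribed i = begin
    lookup (J₀ (J₀ K)) (cpred i) ≡⟨ cong (λ X → lookup X (cpred i)) (J₀-involutive K) ⟩
    lookup K (cpred i)           ≡⟨ lookup∘tabulate (g ∘ csuc) (cpred i) ⟩
    g (csuc (cpred i))           ≡⟨ cong g (csuc-cpred i) ⟩
    g i                          ∎
  unique : ∀ {J} → (∀ i → lookup (J₀ J) (cpred i) ≡ g i) → J₀ K ≡ J
  unique {J} J₀≡ = trans (cong J₀ K≡J₀J) (J₀-involutive J)
    where
    K≡J₀J : K ≡ J₀ J
    K≡J₀J = lookup-ext λ y → begin
      lookup K y                     ≡⟨ lookup∘tabulate (g ∘ csuc) y ⟩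
      g (csuc y)                     ≡⟨ J₀≡ (csuc y) ⟨
      lookup (J₀ J) (cpred (csuc y)) ≡⟨ cong (lookup (J₀ J)) (cpred-csuc y) ⟩
      lookup (J₀ J) y                ∎

irregular⇒extreme : ∀ p k c → ¬ RegularΘ p k c → ∀ i → ∃[ e ] (digit p c (toℕ {suc k} i) ≡ extremeDigit p e)
irregular⇒extreme p k c irregular i with digit p c (toℕ i) ≟ 0 | digit p c (toℕ i) ≟ p ∸ 1
... | yes cᵢ≡0 | _          = false , cᵢ≡0
... | no _     | yes cᵢ≡p-1 = true , cᵢ≡p-1
... | no cᵢ≢0  | no cᵢ≢p-1  =
  contradiction (i , n≢0⇒n>0 cᵢ≢0 , ≤∧≢⇒< (digit≤pred p c (toℕ i)) cᵢ≢p-1) irregular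

irregular⇒∃!regularWeight : ∀ q k b c → ¬ RegularΘ (suc (suc q)) k c →
  ∃! _≡_ (λ (J : Subset (suc k)) →
           InP (suc (suc q)) k c J × RegularWeight (suc (suc q)) (ΘbarJ (suc (suc q)) k b c J))
irregular⇒∃!regularWeight q k b c irregular =
  let J , prescribed , unique = ∃!-J₀-prescribed-on-cpred (proj₁ ∘ extreme)
  in  J , from (characterise J) prescribed , unique ∘ to (characterise _)
  where
  extreme : ∀ i → ∃[ e ] (digit (suc (suc q)) c (toℕ {suc k} i) ≡ extremeDigit (suc (suc q)) e)
  extreme = irregular⇒extreme (suc (suc q)) k c irregular
  characterise : ∀ J → (InP (suc (suc q)) k c J × RegularWeight (suc (suc q)) (ΘbarJ (suc (suc q)) k b c J))
                     ⇔ (∀ i → lookup (J₀ J) (cpred i) ≡ proj₁ (extreme i))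
  characterise = ∈P×regular⇔J₀-prescribed q k b c (proj₁ ∘ extreme) (proj₂ ∘ extreme)

lemma3p3p1 : (p k : ℕ) → Prime p → (b c : ℕ) → b ≤ p ^ suc k ∸ 2 → c ≤ p ^ suc k ∸ 1 →
  (RegularΘ p k c ⇔ (∃[ i ] (InP p k c (upperSet i) × InP p k c (lowerSet i))))
  × (¬ RegularΘ p k c →
      ∃! _≡_ (λ (J : Subset (suc k)) → InP p k c J × RegularWeight p (ΘbarJ p k b c J)))
lemma3p3p1 zero          k p-prime = contradiction p-prime ¬prime[0]
lemma3p3p1 (suc zero)    k p-prime = contradiction p-prime ¬prime[1]
lemma3p3p1 (suc (suc q)) k _ b c _ _ =
  regularΘ⇔∃upperSet∈P×lowerSet∈P (suc (suc q)) k c , irregular⇒∃!regularWeight q k b c
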